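{- For $n\ge 4$, $$\widetilde D_n(x)=\sum_{i=0}^{n-2}\big((n-i-1)x+i+1\big)\big(xT_{n-1,i}(x)+T_{n-1,n+i-1}(x)\big).$$
   Context: A signed permutation of $[n]$ is a bijection $\sigma$ of $\{\pm1,\dots,\pm n\}$ with $\sigma(-i)=-\sigma(i)$, in one-line notation $(\sigma_1,\dots,\sigma_n)$. $D_n$ is the set of signed permutations with an even number of negative entries. For $\sigma\in D_n$, $\widetilde{\operatorname{Des}}_D\sigma=\{0:\text{if }\sigma_1+\sigma_2<0\}\cup\{i\in[n-1]:\sigma_i>\sigma_{i+1}\}\cup\{n:\text{if }\sigma_{n-1}+\sigma_n>0\}$, and $\widetilde D_n(x)=\sum_{\sigma\in D_n}x^{|\widetilde{\operatorname{Des}}_D\sigma|}$ (the affine Eulerian polynomial of the Weyl group of type $D_n$). $I_m$ is the set of integer sequences $\mathbf e=(e_1,\dots,e_m)$ with $0\le e_k<2k$; $\operatorname{Asc}_D\mathbf e=\{k\in[m-1]: e_k/k<e_{k+1}/(k+1)\}\cup\{0:\text{if } e_1+e_2/2\ge3/2\}$, $\operatorname{asc}_D\mathbf e=|\operatorname{Asc}_D\mathbf e|$; $T_{m,i}(x)=\sum_{\mathbf e\in I_m,\ e_m=i}x^{\operatorname{asc}_D\mathbf e}$. -}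

module Defs where

open import Data.Nat using (ℕ; zero; suc; _+_; _*_; _∸_; _<ᵇ_; _≡ᵇ_)
open import Data.Bool using (Bool; true; false; if_then_else_; _∧_; not)
open import Data.List using (List; []; _∷_; map; concatMap; upTo; length; sum; filter; _++_; [_]; foldr; all)
open import Data.Integer as ℤ using (ℤ; +_; -_; ∣_∣)
open import Data.Nat.Properties using (_≟_)
import Data.Integer.Properties as ℤP
open import Relation.Nullary.Decidable using (⌊_⌋)

-- Polynomials in x with natural coefficients, as coefficient sequences:
-- a polynomial P is the function k ↦ [x^k] P.

Poly : Set
Poly = ℕ → ℕ

mono : ℕ → Poly
mono d k = if k ≡ᵇ d then 1 else 0

_⊕_ : Poly → Poly → Poly
(p ⊕ q) k = p k + q k

sumTo : ℕ → (ℕ → ℕ) → ℕ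
sumTo zero    f = f 0
sumTo (suc k) f = sumTo k f + f (suc k)

_⊗_ : Poly → Poly → Poly
(p ⊗ q) k = sumTo k (λ j → p j * q (k ∸ j))

zeroP : Poly
zeroP _ = 0

sumP : List Poly → Poly
sumP = foldr _⊕_ zeroP

lin : ℕ → ℕ → Poly
lin a b zero          = b
lin a b (suc zero)    = a
lin a b (suc (suc _)) = 0

genPoly : {A : Set} → List A → (A → ℕ) → Poly
genPoly xs stat = sumP (map (λ s → mono (stat s)) xs)

-- Signed permutations in one-line notation (σ₁,…,σₙ) as lists of integers.

words : {A : Set} → ℕ → List A → List (List A)
words zero    cs = [] ∷ []
words (suc n) cs = concatMap (λ c → map (c ∷_) (words n cs)) cs

signedVals : ℕ → List ℤ
signedVals n = concatMap (λ i → (+ suc i) ∷ (- (+ suc i)) ∷ []) (upTo n)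

elemℕ : ℕ → List ℕ → Bool
elemℕ a []       = false
elemℕ a (b ∷ bs) = (a ≡ᵇ b) ∨' elemℕ a bs
  where
  _∨'_ : Bool → Bool → Bool
  true  ∨' _ = true
  false ∨' b = b

distinct : List ℕ → Bool
distinct []       = true
distinct (a ∷ as) = not (elemℕ a as) ∧ distinct as

-- a word over ±[n] of length n is (the one-line notation of) a signed
-- permutation iff its absolute values are pairwise distinct
-- (hence form exactly the set [n]).
isSignedPerm : List ℤ → Bool
isSignedPerm σ = distinct (map ∣_∣ σ)

isNeg : ℤ → Bool
isNeg z = ⌊ z ℤ.<? + 0 ⌋

negCount : List ℤ → ℕ
negCount []       = 0
negCount (z ∷ zs) = (if isNeg z then 1 else 0) + negCount zs

isEven : ℕ → Bool
isEven zero          = true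
isEven (suc zero)    = false
isEven (suc (suc n)) = isEven n

signedPerms : ℕ → List (List ℤ)
signedPerms n = filter (λ σ → isSignedPerm σ Data.Bool.≟ true) (words n (signedVals n))

Dn : ℕ → List (List ℤ)
Dn n = filter (λ σ → isEven (negCount σ) Data.Bool.≟ true) (signedPerms n)

ind : Bool → ℕ
ind b = if b then 1 else 0

plainDes : List ℤ → ℕ
plainDes []             = 0
plainDes (a ∷ [])       = 0
plainDes (a ∷ b ∷ rest) = ind ⌊ b ℤ.<? a ⌋ + plainDes (b ∷ rest)

lastTwoSumPos : List ℤ → Bool
lastTwoSumPos []             = false
lastTwoSumPos (a ∷ [])       = false
lastTwoSumPos (a ∷ b ∷ [])   = ⌊ + 0 ℤ.<? a ℤ.+ b ⌋
lastTwoSumPos (a ∷ b ∷ c ∷ r) = lastTwoSumPos (b ∷ c ∷ r)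

firstTwoSumNeg : List ℤ → Bool
firstTwoSumNeg (a ∷ b ∷ _) = ⌊ a ℤ.+ b ℤ.<? + 0 ⌋
firstTwoSumNeg _           = false

-- |Des~_D σ| : 0 ∈ Des iff σ₁+σ₂<0; i ∈ Des iff σ_i>σ_{i+1}; n ∈ Des iff σ_{n-1}+σ_n>0
affDesD : List ℤ → ℕ
affDesD σ = ind (firstTwoSumNeg σ) + plainDes σ + ind (lastTwoSumPos σ)

affineEulerianD : ℕ → Poly
affineEulerianD n = genPoly (Dn n) affDesD

snoc : {A : Set} → List A → A → List A
snoc xs a = xs ++ [ a ]

Iseq : ℕ → List (List ℕ)
Iseq zero    = [] ∷ []
Iseq (suc m) = concatMap (λ e → map (snoc e) (upTo (2 * suc m))) (Iseq m)

-- number of k ∈ [m-1] with e_k/k < e_{k+1}/(k+1), i.e. e_k (k+1) < e_{k+1} k;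
-- the argument k is the index of the head of the list.
ascFrom : ℕ → List ℕ → ℕ
ascFrom k []             = 0
ascFrom k (a ∷ [])       = 0
ascFrom k (a ∷ b ∷ rest) = ind (a * suc k <ᵇ b * k) + ascFrom (suc k) (b ∷ rest)

-- 0 ∈ Asc_D e iff e_1 + e_2/2 ≥ 3/2, i.e. 2 e_1 + e_2 ≥ 3
zeroAsc : List ℕ → Bool
zeroAsc (e1 ∷ e2 ∷ _) = 2 <ᵇ 2 * e1 + e2
zeroAsc _             = false

ascD : List ℕ → ℕ
ascD e = ind (zeroAsc e) + ascFrom 1 e

lastIs : ℕ → List ℕ → Bool
lastIs i []           = false
lastIs i (a ∷ [])     = a ≡ᵇ i
lastIs i (a ∷ b ∷ r)  = lastIs i (b ∷ r)

T : ℕ → ℕ → Poly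
T m i = genPoly (filter (λ e → lastIs i e Data.Bool.≟ true) (Iseq m)) ascD

rhsD : ℕ → Poly
rhsD n = sumP (map (λ i → lin (n ∸ i ∸ 1) (i + 1) ⊗ ((mono 1 ⊗ T (n ∸ 1) i) ⊕ T (n ∸ 1) (n + i ∸ 1)))
                   (upTo (n ∸ 1)))

-- Write σ ∈ D_n as a word ending in c = ±(b+1), and standardise the first n − 1 letters to a
-- signed permutation τ of [n−1].  The two signs of c give the same number of affine descents,
-- and exactly one of them has the right parity, so D̃_n(x) = Σ_{τ,b} x^(des_D τ + ε), where ε,
-- the number of descents at the last two positions, only depends on b and on the last letter
-- of τ.  Counting the b with ε = 0, 1, 2 turns D̃_n into the right-hand side, with T_{n−1,j}
-- replaced by the des_D-polynomial of the signed permutations of [n−1] ending in the letter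
-- +(n−1−j) (for j < n−1) or −(j−n+2) (for j ≥ n−1).  These two families agree because both
-- satisfy the same recurrence in the last letter: removing it from τ, a descent τ_{m−1} > τ_m
-- corresponds exactly to an ascent e_{m−1}/(m−1) < e_m/m, and they agree for m = 2.
module Submission where

open import Defs
open import Data.Nat using (ℕ; zero; suc; _+_; _*_; _∸_; _≤_; _<_; z≤n; s≤s; s≤s⁻¹; _<ᵇ_; _≡ᵇ_)
open import Data.Nat.Properties
open import Data.Nat.Solver using (module +-*-Solver)
open import Algebra.Properties.CommutativeSemigroup +-commutativeSemigroup using (interchange; xy∙z≈xz∙y; x∙yz≈z∙xy)
open import Data.Bool using (Bool; true; false; if_then_else_; _∧_; _∨_; not)
open import Data.Bool.Properties using (∨-zeroʳ; ∧-zeroʳ)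
open import Data.List using (List; []; _∷_; map; concatMap; upTo; length; filter; _++_; [_])
open import Data.List.Properties using (upTo-∷ʳ; map-++; ++-assoc)
open import Data.Integer as ℤ using (ℤ; -[1+_]; -_; ∣_∣)
import Data.Integer.Properties as ℤ
open import Data.Product using (_×_; _,_; proj₁; proj₂)
open import Data.Sum using (inj₁; inj₂)
open import Function.Bundles using (mk⇔)
open import Relation.Nullary using (Dec; yes; no)
open import Relation.Nullary.Decidable using (⌊_⌋; isYes≗does; does-⇔)
open import Relation.Binary.PropositionalEquality hiding ([_])
open ≡-Reasoning
open +-*-Solver using (solve; _:+_; _:*_; _:=_; con)

-- Finite sums

∑ : {A : Set} → List A → (A → ℕ) → ℕ
∑ []       f = 0
∑ (x ∷ xs) f = f x + ∑ xs f

syntax ∑ xs (λ x → e) = ∑[ x ∈ xs ] e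

∑< : ℕ → (ℕ → ℕ) → ℕ
∑< zero    f = 0
∑< (suc n) f = ∑< n f + f n

syntax ∑< n (λ i → e) = ∑[ i < n ] e

module _ {A : Set} where

  ∑-cong : (xs : List A) {f g : A → ℕ} → (∀ x → f x ≡ g x) → ∑ xs f ≡ ∑ xs g
  ∑-cong []       eq = refl
  ∑-cong (x ∷ xs) eq = cong₂ _+_ (eq x) (∑-cong xs eq)

  ∑-zero : (xs : List A) (f : A → ℕ) → (∀ x → f x ≡ 0) → ∑ xs f ≡ 0
  ∑-zero []       f f≡0 = refl
  ∑-zero (x ∷ xs) f f≡0 = cong₂ _+_ (f≡0 x) (∑-zero xs f f≡0)

  ∑-++ : (xs ys : List A) (f : A → ℕ) → ∑ (xs ++ ys) f ≡ ∑ xs f + ∑ ys f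
  ∑-++ []       ys f = refl
  ∑-++ (x ∷ xs) ys f = trans (cong (f x +_) (∑-++ xs ys f)) (sym (+-assoc (f x) _ _))

  ∑-+ : (xs : List A) (f g : A → ℕ) → ∑[ x ∈ xs ] (f x + g x) ≡ ∑ xs f + ∑ xs g
  ∑-+ []       f g = refl
  ∑-+ (x ∷ xs) f g =
    trans (cong (f x + g x +_) (∑-+ xs f g)) (interchange (f x) (g x) (∑ xs f) (∑ xs g))

module _ {A B : Set} where

  ∑-map : (h : A → B) (xs : List A) (f : B → ℕ) → ∑ (map h xs) f ≡ ∑[ x ∈ xs ] f (h x)
  ∑-map h []       f = refl
  ∑-map h (x ∷ xs) f = cong (f (h x) +_) (∑-map h xs f)

  ∑-concatMap : (h : A → List B) (xs : List A) (f : B → ℕ) →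
                ∑ (concatMap h xs) f ≡ ∑[ x ∈ xs ] ∑ (h x) f
  ∑-concatMap h []       f = refl
  ∑-concatMap h (x ∷ xs) f =
    trans (∑-++ (h x) (concatMap h xs) f) (cong (∑ (h x) f +_) (∑-concatMap h xs f))

  ∑-comm : (xs : List A) (ys : List B) (f : A → B → ℕ) →
           ∑[ x ∈ xs ] ∑[ y ∈ ys ] f x y ≡ ∑[ y ∈ ys ] ∑[ x ∈ xs ] f x y
  ∑-comm []       ys f = sym (∑-zero ys _ (λ _ → refl))
  ∑-comm (x ∷ xs) ys f = trans (cong (∑ ys (f x) +_) (∑-comm xs ys f))
                               (sym (∑-+ ys (f x) (λ y → ∑[ x ∈ xs ] f x y)))

∑-upTo : (n : ℕ) (f : ℕ → ℕ) → ∑ (upTo n) f ≡ ∑< n f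
∑-upTo zero    f = refl
∑-upTo (suc n) f = begin
  ∑ (upTo (suc n)) f          ≡⟨ cong (λ l → ∑ l f) (sym (upTo-∷ʳ n)) ⟩
  ∑ (upTo n ++ [ n ]) f       ≡⟨ ∑-++ (upTo n) [ n ] f ⟩
  ∑ (upTo n) f + (f n + 0)    ≡⟨ cong₂ _+_ (∑-upTo n f) (+-identityʳ (f n)) ⟩
  ∑< n f + f n                ∎

∑<-cong : (n : ℕ) {f g : ℕ → ℕ} → (∀ i → i < n → f i ≡ g i) → ∑< n f ≡ ∑< n g
∑<-cong zero    eq = refl
∑<-cong (suc n) eq = cong₂ _+_ (∑<-cong n (λ i i<n → eq i (m<n⇒m<1+n i<n))) (eq n ≤-refl)

∑<-zero : (n : ℕ) (f : ℕ → ℕ) → (∀ i → i < n → f i ≡ 0) → ∑< n f ≡ 0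
∑<-zero zero    f f≡0 = refl
∑<-zero (suc n) f f≡0 = cong₂ _+_ (∑<-zero n f (λ i i<n → f≡0 i (m<n⇒m<1+n i<n))) (f≡0 n ≤-refl)

∑<-+ : (n : ℕ) (f g : ℕ → ℕ) → ∑[ i < n ] (f i + g i) ≡ ∑< n f + ∑< n g
∑<-+ zero    f g = refl
∑<-+ (suc n) f g = trans (cong (_+ (f n + g n)) (∑<-+ n f g)) (interchange (∑< n f) (∑< n g) (f n) (g n))

∑<-const : (n x : ℕ) → ∑[ _ < n ] x ≡ n * x
∑<-const zero    x = refl
∑<-const (suc n) x = trans (cong (_+ x) (∑<-const n x)) (+-comm (n * x) x)

∑<-split : (a b : ℕ) (f : ℕ → ℕ) → ∑< (a + b) f ≡ ∑< a f + ∑[ i < b ] f (a + i)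
∑<-split a zero    f = trans (cong (λ x → ∑< x f) (+-identityʳ a)) (sym (+-identityʳ _))
∑<-split a (suc b) f = begin
  ∑< (a + suc b) f                               ≡⟨ cong (λ x → ∑< x f) (+-suc a b) ⟩
  ∑< (a + b) f + f (a + b)                       ≡⟨ cong (_+ f (a + b)) (∑<-split a b f) ⟩
  ∑< a f + ∑[ i < b ] f (a + i) + f (a + b)      ≡⟨ +-assoc (∑< a f) _ _ ⟩
  ∑< a f + ∑[ i < suc b ] f (a + i)              ∎

∑<-suc : (n : ℕ) (f : ℕ → ℕ) → ∑< (suc n) f ≡ f 0 + ∑[ i < n ] f (suc i)
∑<-suc zero    f = +-comm 0 (f 0)
∑<-suc (suc n) f = trans (cong (_+ f (suc n)) (∑<-suc n f)) (+-assoc (f 0) _ _)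

∑<-reverse : (n : ℕ) (f : ℕ → ℕ) → ∑< n f ≡ ∑[ i < n ] f (n ∸ suc i)
∑<-reverse zero    f = refl
∑<-reverse (suc n) f = begin
  ∑< n f + f n                            ≡⟨ +-comm (∑< n f) (f n) ⟩
  f n + ∑< n f                            ≡⟨ cong (f n +_) (∑<-reverse n f) ⟩
  f n + ∑[ i < n ] f (n ∸ suc i)          ≡⟨ sym (∑<-suc n (λ i → f (suc n ∸ suc i))) ⟩
  ∑[ i < suc n ] f (suc n ∸ suc i)        ∎

∑<-comm∑ : {A : Set} (n : ℕ) (xs : List A) (f : ℕ → A → ℕ) →
           ∑[ i < n ] ∑ xs (f i) ≡ ∑[ x ∈ xs ] ∑[ i < n ] f i x
∑<-comm∑ n xs f = begin
  ∑[ i < n ] ∑ xs (f i)                  ≡⟨ sym (∑-upTo n _) ⟩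
  ∑[ i ∈ upTo n ] ∑ xs (f i)             ≡⟨ ∑-comm (upTo n) xs f ⟩
  ∑[ x ∈ xs ] ∑[ i ∈ upTo n ] f i x      ≡⟨ ∑-cong xs (λ x → ∑-upTo n _) ⟩
  ∑[ x ∈ xs ] ∑[ i < n ] f i x           ∎

∑<-twoValued : (n i x y : ℕ) (f : ℕ → ℕ) → i < n →
               (∀ b → b ≤ i → f b ≡ x) → (∀ b → i < b → f b ≡ y) →
               ∑< n f ≡ suc i * x + (n ∸ suc i) * y
∑<-twoValued n i x y f i<n f≡x f≡y = begin
  ∑< n f                                             ≡⟨ cong (λ t → ∑< t f) (sym (m+[n∸m]≡n i<n)) ⟩
  ∑< (suc i + (n ∸ suc i)) f                         ≡⟨ ∑<-split (suc i) (n ∸ suc i) f ⟩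
  ∑< (suc i) f + ∑[ j < n ∸ suc i ] f (suc i + j)
    ≡⟨ cong₂ _+_ (trans (∑<-cong (suc i) (λ b b≤i → f≡x b (s≤s⁻¹ b≤i))) (∑<-const (suc i) x))
                 (trans (∑<-cong (n ∸ suc i) (λ j _ → f≡y (suc i + j) (s≤s (m≤m+n i j))))
                        (∑<-const (n ∸ suc i) y)) ⟩
  suc i * x + (n ∸ suc i) * y                        ∎

≡ᵇ-refl : ∀ a → (a ≡ᵇ a) ≡ true
≡ᵇ-refl zero    = refl
≡ᵇ-refl (suc a) = ≡ᵇ-refl a

<⇒≡ᵇ-false : ∀ {a b} → a < b → (a ≡ᵇ b) ≡ false
<⇒≡ᵇ-false {zero}  {suc b} _       = refl
<⇒≡ᵇ-false {suc a} {suc b} (s≤s p) = <⇒≡ᵇ-false p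

>⇒≡ᵇ-false : ∀ {a b} → b < a → (a ≡ᵇ b) ≡ false
>⇒≡ᵇ-false {suc a} {zero}  _       = refl
>⇒≡ᵇ-false {suc a} {suc b} (s≤s p) = >⇒≡ᵇ-false p

<⇒<ᵇ-true : ∀ {a b} → a < b → (a <ᵇ b) ≡ true
<⇒<ᵇ-true {zero}  {suc b} _       = refl
<⇒<ᵇ-true {suc a} {suc b} (s≤s p) = <⇒<ᵇ-true p

≥⇒<ᵇ-false : ∀ {a b} → b ≤ a → (a <ᵇ b) ≡ false
≥⇒<ᵇ-false {a}     {zero}  _       = refl
≥⇒<ᵇ-false {suc a} {suc b} (s≤s p) = ≥⇒<ᵇ-false p

∑<-pick : (n j : ℕ) (f : ℕ → ℕ) → j < n → ∑[ t < n ] (ind (t ≡ᵇ j) * f t) ≡ f j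
∑<-pick (suc n) j f j<1+n with m≤n⇒m<n∨m≡n (s≤s⁻¹ j<1+n)
... | inj₁ j<n = begin
  ∑[ t < n ] (ind (t ≡ᵇ j) * f t) + ind (n ≡ᵇ j) * f n   ≡⟨ cong₂ _+_ (∑<-pick n j f j<n)
                                                               (cong (λ b → ind b * f n) (>⇒≡ᵇ-false j<n)) ⟩
  f j + 0                                               ≡⟨ +-identityʳ (f j) ⟩
  f j                                                   ∎
... | inj₂ refl = begin
  ∑[ t < n ] (ind (t ≡ᵇ n) * f t) + ind (n ≡ᵇ n) * f n
    ≡⟨ cong₂ _+_ (∑<-zero n _ (λ t t<n → cong (λ b → ind b * f t) (<⇒≡ᵇ-false t<n)))
                 (cong (λ b → ind b * f n) (≡ᵇ-refl n)) ⟩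
  1 * f n                                               ≡⟨ *-identityˡ (f n) ⟩
  f n                                                   ∎

infixr 7 x^_·_

x^_·_ : ℕ → Poly → Poly
(x^ zero  · p) k       = p k
(x^ suc e · p) zero    = 0
(x^ suc e · p) (suc k) = (x^ e · p) k

x^·-cong : (e : ℕ) {p q : Poly} → p ≗ q → x^ e · p ≗ x^ e · q
x^·-cong zero    p≗q k       = p≗q k
x^·-cong (suc e) p≗q zero    = refl
x^·-cong (suc e) p≗q (suc k) = x^·-cong e p≗q k

x^·-⊕ : (e : ℕ) (p q : Poly) → x^ e · (p ⊕ q) ≗ (x^ e · p) ⊕ (x^ e · q)
x^·-⊕ zero    p q k       = refl
x^·-⊕ (suc e) p q zero    = refl
x^·-⊕ (suc e) p q (suc k) = x^·-⊕ e p q k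

x^·-x^· : (a b : ℕ) (p : Poly) → x^ a · x^ b · p ≗ x^ (a + b) · p
x^·-x^· zero    b p k       = refl
x^·-x^· (suc a) b p zero    = refl
x^·-x^· (suc a) b p (suc k) = x^·-x^· a b p k

x^·-∑ : {A : Set} (xs : List A) (e : ℕ) (f : A → Poly) →
        x^ e · (λ k → ∑[ x ∈ xs ] f x k) ≗ (λ k → ∑[ x ∈ xs ] (x^ e · f x) k)
x^·-∑ xs zero    f k       = refl
x^·-∑ xs (suc e) f zero    = sym (∑-zero xs _ (λ _ → refl))
x^·-∑ xs (suc e) f (suc k) = x^·-∑ xs e f k

mono-+ : (e d : ℕ) → mono (e + d) ≗ x^ e · mono d
mono-+ zero    d k       = refl
mono-+ (suc e) d zero    = refl
mono-+ (suc e) d (suc k) = mono-+ e d k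

*-mono-+ : (c e d : ℕ) → (λ k → c * mono (e + d) k) ≗ x^ e · (λ k → c * mono d k)
*-mono-+ c zero    d k       = refl
*-mono-+ c (suc e) d zero    = *-zeroʳ c
*-mono-+ c (suc e) d (suc k) = *-mono-+ c e d k

∑-*-mono-+ : {A : Set} (xs : List A) (e : ℕ) (c d : A → ℕ) →
             (λ k → ∑[ x ∈ xs ] (c x * mono (e + d x) k)) ≗ x^ e · (λ k → ∑[ x ∈ xs ] (c x * mono (d x) k))
∑-*-mono-+ xs e c d k =
  trans (∑-cong xs (λ x → *-mono-+ (c x) e (d x) k)) (sym (x^·-∑ xs e (λ x k → c x * mono (d x) k) k))

sumTo-two : (k : ℕ) (g : ℕ → ℕ) → (∀ j → g (suc (suc j)) ≡ 0) → sumTo (suc k) g ≡ g 0 + g 1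
sumTo-two zero    g g≡0 = refl
sumTo-two (suc k) g g≡0 = trans (cong₂ _+_ (sumTo-two k g g≡0) (g≡0 k)) (+-identityʳ _)

lin⊗ : (a c : ℕ) (p : Poly) → lin a c ⊗ p ≗ (λ k → c * p k + a * (x^ 1 · p) k)
lin⊗ a c p zero    = sym (trans (cong (c * p 0 +_) (*-zeroʳ a)) (+-identityʳ _))
lin⊗ a c p (suc k) = sumTo-two k _ (λ j → refl)

mono1⊗ : (p : Poly) → mono 1 ⊗ p ≗ x^ 1 · p
mono1⊗ p zero    = refl
mono1⊗ p (suc k) = trans (sumTo-two k _ (λ j → refl)) (+-identityʳ (p k))

sumP-map : {A : Set} (f : A → Poly) (xs : List A) → sumP (map f xs) ≗ (λ k → ∑[ x ∈ xs ] f x k)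
sumP-map f []       k = refl
sumP-map f (x ∷ xs) k = cong (f x k +_) (sumP-map f xs k)

genPoly-∑ : {A : Set} (xs : List A) (stat : A → ℕ) → genPoly xs stat ≗ (λ k → ∑[ x ∈ xs ] mono (stat x) k)
genPoly-∑ xs stat = sumP-map (λ s → mono (stat s)) xs

∑-filter : {A : Set} (b : A → Bool) (xs : List A) (f : A → ℕ) →
           ∑ (filter (λ x → b x Data.Bool.≟ true) xs) f ≡ ∑[ x ∈ xs ] (ind (b x) * f x)
∑-filter b []       f = refl
∑-filter b (x ∷ xs) f with b x
... | true  = cong₂ _+_ (sym (+-identityʳ (f x))) (∑-filter b xs f)
... | false = ∑-filter b xs f

-- Punching in a value

punchIn : ℕ → ℕ → ℕ
punchIn b i = if i <ᵇ b then i else suc i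

punchIn-< : ∀ {b i} → i < b → punchIn b i ≡ i
punchIn-< p rewrite <⇒<ᵇ-true p = refl

punchIn-≥ : ∀ {b i} → b ≤ i → punchIn b i ≡ suc i
punchIn-≥ p rewrite ≥⇒<ᵇ-false p = refl

punchIn-<ᵇ : (b i j : ℕ) → (punchIn b i <ᵇ punchIn b j) ≡ (i <ᵇ j)
punchIn-<ᵇ b i j with i <? b | j <? b
... | yes i<b | yes j<b rewrite punchIn-< i<b | punchIn-< j<b = refl
... | yes i<b | no j≮b rewrite punchIn-< i<b | punchIn-≥ (≮⇒≥ j≮b) =
  trans (<⇒<ᵇ-true (<-≤-trans i<b (m≤n⇒m≤1+n (≮⇒≥ j≮b)))) (sym (<⇒<ᵇ-true (<-≤-trans i<b (≮⇒≥ j≮b))))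
... | no i≮b | yes j<b rewrite punchIn-≥ (≮⇒≥ i≮b) | punchIn-< j<b =
  trans (≥⇒<ᵇ-false (≤-trans (<⇒≤ j<b) (m≤n⇒m≤1+n (≮⇒≥ i≮b)))) (sym (≥⇒<ᵇ-false (≤-trans (<⇒≤ j<b) (≮⇒≥ i≮b))))
... | no i≮b | no j≮b rewrite punchIn-≥ (≮⇒≥ i≮b) | punchIn-≥ (≮⇒≥ j≮b) = refl

punchIn-≡ᵇ : (b i j : ℕ) → (punchIn b i ≡ᵇ punchIn b j) ≡ (i ≡ᵇ j)
punchIn-≡ᵇ b i j with i <? b | j <? b
... | yes i<b | yes j<b rewrite punchIn-< i<b | punchIn-< j<b = refl
... | yes i<b | no j≮b rewrite punchIn-< i<b | punchIn-≥ (≮⇒≥ j≮b) =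
  trans (<⇒≡ᵇ-false (<-≤-trans i<b (m≤n⇒m≤1+n (≮⇒≥ j≮b)))) (sym (<⇒≡ᵇ-false (<-≤-trans i<b (≮⇒≥ j≮b))))
... | no i≮b | yes j<b rewrite punchIn-≥ (≮⇒≥ i≮b) | punchIn-< j<b =
  trans (>⇒≡ᵇ-false (s≤s (≤-trans (<⇒≤ j<b) (≮⇒≥ i≮b)))) (sym (>⇒≡ᵇ-false (<-≤-trans j<b (≮⇒≥ i≮b))))
... | no i≮b | no j≮b rewrite punchIn-≥ (≮⇒≥ i≮b) | punchIn-≥ (≮⇒≥ j≮b) = refl

punchIn-≢ : (b i : ℕ) → (punchIn b i ≡ᵇ b) ≡ false
punchIn-≢ b i with i <? b
... | yes i<b rewrite punchIn-< i<b = <⇒≡ᵇ-false i<b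
... | no i≮b rewrite punchIn-≥ (≮⇒≥ i≮b) = >⇒≡ᵇ-false (s≤s (≮⇒≥ i≮b))

∑<-punchIn : (n b : ℕ) → b ≤ n → (f : ℕ → ℕ) → f b ≡ 0 → ∑< (suc n) f ≡ ∑[ i < n ] f (punchIn b i)
∑<-punchIn n b b≤n f fb≡0 with m≤n⇒m<n∨m≡n b≤n
... | inj₂ refl = begin
  ∑< n f + f n                        ≡⟨ cong (∑< n f +_) fb≡0 ⟩
  ∑< n f + 0                          ≡⟨ +-identityʳ _ ⟩
  ∑< n f                              ≡⟨ ∑<-cong n (λ i i<n → cong f (sym (punchIn-< i<n))) ⟩
  ∑[ i < n ] f (punchIn n i)          ∎
∑<-punchIn (suc n) b _ f fb≡0 | inj₁ (s≤s b≤n) = begin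
  ∑< (suc n) f + f (suc n)                       ≡⟨ cong (_+ f (suc n)) (∑<-punchIn n b b≤n f fb≡0) ⟩
  ∑[ i < n ] f (punchIn b i) + f (suc n)         ≡⟨ cong (λ x → ∑[ i < n ] f (punchIn b i) + f x)
                                                         (sym (punchIn-≥ b≤n)) ⟩
  ∑[ i < suc n ] f (punchIn b i)                 ∎

infix 4 _<ℤᵇ_

_<ℤᵇ_ : ℤ → ℤ → Bool
ℤ.+ m    <ℤᵇ ℤ.+ n    = m <ᵇ n
ℤ.+ m    <ℤᵇ -[1+ n ] = false
-[1+ m ] <ℤᵇ ℤ.+ n    = true
-[1+ m ] <ℤᵇ -[1+ n ] = n <ᵇ m

<?-<ℤᵇ : (x y : ℤ) → ⌊ x ℤ.<? y ⌋ ≡ (x <ℤᵇ y)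
<?-<ℤᵇ (ℤ.+ m)  (ℤ.+ n)  = isYes≗does (ℤ.+ m ℤ.<? ℤ.+ n)
<?-<ℤᵇ (ℤ.+ m)  -[1+ n ] = refl
<?-<ℤᵇ -[1+ m ] (ℤ.+ n)  = refl
<?-<ℤᵇ -[1+ m ] -[1+ n ] = isYes≗does (-[1+ m ] ℤ.<? -[1+ n ])

⌊⌋-⇔ : {P Q : Set} (p : Dec P) (q : Dec Q) → (P → Q) → (Q → P) → ⌊ p ⌋ ≡ ⌊ q ⌋
⌊⌋-⇔ p q f g = trans (isYes≗does p) (trans (does-⇔ (mk⇔ f g) p q) (sym (isYes≗does q)))

x+y-y≡x : (x y : ℤ) → x ℤ.+ y ℤ.+ - y ≡ x
x+y-y≡x x y = trans (ℤ.+-assoc x y (- y)) (trans (cong (λ t → x ℤ.+ t) (ℤ.+-inverseʳ y)) (ℤ.+-identityʳ x))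

⌊x+y<0⌋≡⌊x<-y⌋ : (x y : ℤ) → ⌊ x ℤ.+ y ℤ.<? ℤ.+ 0 ⌋ ≡ ⌊ x ℤ.<? - y ⌋
⌊x+y<0⌋≡⌊x<-y⌋ x y = ⌊⌋-⇔ (x ℤ.+ y ℤ.<? ℤ.+ 0) (x ℤ.<? - y)
  (λ p → subst₂ ℤ._<_ (x+y-y≡x x y) (ℤ.+-identityˡ (- y)) (ℤ.+-monoˡ-< (- y) p))
  (λ p → subst (x ℤ.+ y ℤ.<_) (ℤ.+-inverseˡ y) (ℤ.+-monoˡ-< y p))

⌊0<x+y⌋≡⌊-y<x⌋ : (x y : ℤ) → ⌊ ℤ.+ 0 ℤ.<? x ℤ.+ y ⌋ ≡ ⌊ - y ℤ.<? x ⌋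
⌊0<x+y⌋≡⌊-y<x⌋ x y = ⌊⌋-⇔ (ℤ.+ 0 ℤ.<? x ℤ.+ y) (- y ℤ.<? x)
  (λ p → subst₂ ℤ._<_ (ℤ.+-identityˡ (- y)) (x+y-y≡x x y) (ℤ.+-monoˡ-< (- y) p))
  (λ p → subst (ℤ._< x ℤ.+ y) (ℤ.+-inverseˡ y) (ℤ.+-monoˡ-< y p))

punchInℤ : ℕ → ℤ → ℤ
punchInℤ b (ℤ.+ zero)  = ℤ.+ zero
punchInℤ b (ℤ.+ suc i) = ℤ.+ suc (punchIn b i)
punchInℤ b -[1+ i ]    = -[1+ punchIn b i ]

punchInℤ-<ℤᵇ : (b : ℕ) (x y : ℤ) → (punchInℤ b x <ℤᵇ punchInℤ b y) ≡ (x <ℤᵇ y)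
punchInℤ-<ℤᵇ b (ℤ.+ zero)  (ℤ.+ zero)  = refl
punchInℤ-<ℤᵇ b (ℤ.+ zero)  (ℤ.+ suc j) = refl
punchInℤ-<ℤᵇ b (ℤ.+ zero)  -[1+ j ]    = refl
punchInℤ-<ℤᵇ b (ℤ.+ suc i) (ℤ.+ zero)  = refl
punchInℤ-<ℤᵇ b (ℤ.+ suc i) (ℤ.+ suc j) = punchIn-<ᵇ b i j
punchInℤ-<ℤᵇ b (ℤ.+ suc i) -[1+ j ]    = refl
punchInℤ-<ℤᵇ b -[1+ i ]    (ℤ.+ zero)  = refl
punchInℤ-<ℤᵇ b -[1+ i ]    (ℤ.+ suc j) = refl
punchInℤ-<ℤᵇ b -[1+ i ]    -[1+ j ]    = punchIn-<ᵇ b j i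

punchInℤ-<? : (b : ℕ) (x y : ℤ) → ⌊ punchInℤ b x ℤ.<? punchInℤ b y ⌋ ≡ ⌊ x ℤ.<? y ⌋
punchInℤ-<? b x y = trans (<?-<ℤᵇ _ _) (trans (punchInℤ-<ℤᵇ b x y) (sym (<?-<ℤᵇ x y)))

punchInℤ-neg : (b : ℕ) (x : ℤ) → punchInℤ b (- x) ≡ - punchInℤ b x
punchInℤ-neg b (ℤ.+ zero)  = refl
punchInℤ-neg b (ℤ.+ suc i) = refl
punchInℤ-neg b -[1+ i ]    = refl

isNeg-punchInℤ : (b : ℕ) (z : ℤ) → isNeg (punchInℤ b z) ≡ isNeg z
isNeg-punchInℤ b (ℤ.+ zero)  = refl
isNeg-punchInℤ b (ℤ.+ suc i) = refl
isNeg-punchInℤ b -[1+ i ]    = refl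

negCount-punchInℤ : (b : ℕ) (w : List ℤ) → negCount (map (punchInℤ b) w) ≡ negCount w
negCount-punchInℤ b []      = refl
negCount-punchInℤ b (z ∷ w) = cong₂ _+_ (cong ind (isNeg-punchInℤ b z)) (negCount-punchInℤ b w)

negCount-++ : (xs ys : List ℤ) → negCount (xs ++ ys) ≡ negCount xs + negCount ys
negCount-++ []       ys = refl
negCount-++ (z ∷ xs) ys = trans (cong (ind (isNeg z) +_) (negCount-++ xs ys)) (sym (+-assoc (ind (isNeg z)) _ _))

ind-isEven+ind-isEven-suc : ∀ n → ind (isEven n) + ind (isEven (suc n)) ≡ 1
ind-isEven+ind-isEven-suc zero          = refl
ind-isEven+ind-isEven-suc (suc zero)    = refl
ind-isEven+ind-isEven-suc (suc (suc n)) = ind-isEven+ind-isEven-suc n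

-- Descent statistics

desD : List ℤ → ℕ
desD w = ind (firstTwoSumNeg w) + plainDes w

plainDes-punchInℤ : (b : ℕ) (w : List ℤ) → plainDes (map (punchInℤ b) w) ≡ plainDes w
plainDes-punchInℤ b []          = refl
plainDes-punchInℤ b (x ∷ [])    = refl
plainDes-punchInℤ b (x ∷ y ∷ w) = cong₂ _+_ (cong ind (punchInℤ-<? b y x)) (plainDes-punchInℤ b (y ∷ w))

firstTwoSumNeg-punchInℤ : (b : ℕ) (w : List ℤ) → firstTwoSumNeg (map (punchInℤ b) w) ≡ firstTwoSumNeg w
firstTwoSumNeg-punchInℤ b []          = refl
firstTwoSumNeg-punchInℤ b (x ∷ [])    = refl
firstTwoSumNeg-punchInℤ b (x ∷ y ∷ w) = begin
  ⌊ f x ℤ.+ f y ℤ.<? ℤ.+ 0 ⌋    ≡⟨ ⌊x+y<0⌋≡⌊x<-y⌋ (f x) (f y) ⟩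
  ⌊ f x ℤ.<? - f y ⌋            ≡⟨ cong (λ t → ⌊ f x ℤ.<? t ⌋) (sym (punchInℤ-neg b y)) ⟩
  ⌊ f x ℤ.<? f (- y) ⌋          ≡⟨ punchInℤ-<? b x (- y) ⟩
  ⌊ x ℤ.<? - y ⌋                ≡⟨ sym (⌊x+y<0⌋≡⌊x<-y⌋ x y) ⟩
  ⌊ x ℤ.+ y ℤ.<? ℤ.+ 0 ⌋        ∎
  where f = punchInℤ b

desD-punchInℤ : (b : ℕ) (w : List ℤ) → desD (map (punchInℤ b) w) ≡ desD w
desD-punchInℤ b w = cong₂ _+_ (cong ind (firstTwoSumNeg-punchInℤ b w)) (plainDes-punchInℤ b w)

plainDes-++ : (xs : List ℤ) (x c : ℤ) →
              plainDes (xs ++ x ∷ c ∷ []) ≡ plainDes (xs ++ [ x ]) + ind ⌊ c ℤ.<? x ⌋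
plainDes-++ []           x c = +-comm (ind ⌊ c ℤ.<? x ⌋) 0
plainDes-++ (y ∷ [])     x c =
  trans (cong (ind ⌊ x ℤ.<? y ⌋ +_) (+-identityʳ _)) (cong (_+ ind ⌊ c ℤ.<? x ⌋) (sym (+-identityʳ _)))
plainDes-++ (y ∷ z ∷ zs) x c =
  trans (cong (ind ⌊ z ℤ.<? y ⌋ +_) (plainDes-++ (z ∷ zs) x c)) (sym (+-assoc (ind ⌊ z ℤ.<? y ⌋) _ _))

firstTwoSumNeg-++ : (y : ℤ) (ys : List ℤ) (x c : ℤ) →
                    firstTwoSumNeg (y ∷ ys ++ x ∷ c ∷ []) ≡ firstTwoSumNeg (y ∷ ys ++ [ x ])
firstTwoSumNeg-++ y []       x c = refl
firstTwoSumNeg-++ y (z ∷ zs) x c = refl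

lastTwoSumPos-++ : (xs : List ℤ) (x c : ℤ) → lastTwoSumPos (xs ++ x ∷ c ∷ []) ≡ ⌊ ℤ.+ 0 ℤ.<? x ℤ.+ c ⌋
lastTwoSumPos-++ []               x c = refl
lastTwoSumPos-++ (y ∷ [])         x c = refl
lastTwoSumPos-++ (y ∷ z ∷ [])     x c = refl
lastTwoSumPos-++ (y ∷ z ∷ w ∷ ws) x c = lastTwoSumPos-++ (z ∷ w ∷ ws) x c

map-++-snoc : (f : ℤ → ℤ) (y : ℤ) (ys : List ℤ) (ℓ c : ℤ) →
              map f (y ∷ ys ++ [ ℓ ]) ++ [ c ] ≡ f y ∷ map f ys ++ f ℓ ∷ c ∷ []
map-++-snoc f y ys ℓ c =
  cong (f y ∷_) (trans (cong (_++ [ c ]) (map-++ f ys [ ℓ ])) (++-assoc (map f ys) [ f ℓ ] [ c ]))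

desD-extend : (b : ℕ) (y : ℤ) (ys : List ℤ) (ℓ c : ℤ) →
              desD (map (punchInℤ b) (y ∷ ys ++ [ ℓ ]) ++ [ c ]) ≡ ind ⌊ c ℤ.<? punchInℤ b ℓ ⌋ + desD (y ∷ ys ++ [ ℓ ])
desD-extend b y ys ℓ c = begin
  desD (map f u ++ [ c ])                                         ≡⟨ cong desD (map-++-snoc f y ys ℓ c) ⟩
  ind (firstTwoSumNeg (f y ∷ fys ++ f ℓ ∷ c ∷ [])) + plainDes (f y ∷ fys ++ f ℓ ∷ c ∷ [])
    ≡⟨ cong₂ (λ a p → ind a + p) (firstTwoSumNeg-++ (f y) fys (f ℓ) c) (plainDes-++ (f y ∷ fys) (f ℓ) c) ⟩
  ind (firstTwoSumNeg (f y ∷ fys ++ [ f ℓ ])) + (plainDes (f y ∷ fys ++ [ f ℓ ]) + X)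
    ≡⟨ x∙yz≈z∙xy (ind (firstTwoSumNeg (f y ∷ fys ++ [ f ℓ ]))) (plainDes (f y ∷ fys ++ [ f ℓ ])) X ⟩
  X + desD (f y ∷ fys ++ [ f ℓ ])                                  ≡⟨ cong (λ w → X + desD (f y ∷ w)) (sym (map-++ f ys [ ℓ ])) ⟩
  X + desD (map f u)                                               ≡⟨ cong (X +_) (desD-punchInℤ b u) ⟩
  X + desD u                                                       ∎
  where
  f = punchInℤ b
  u = y ∷ ys ++ [ ℓ ]
  fys = map f ys
  X = ind ⌊ c ℤ.<? f ℓ ⌋

finalDes : ℤ → ℤ → ℕ
finalDes s c = ind ⌊ c ℤ.<? s ⌋ + ind ⌊ ℤ.+ 0 ℤ.<? s ℤ.+ c ⌋

affDesD-extend : (b : ℕ) (y : ℤ) (ys : List ℤ) (ℓ c : ℤ) →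
                 affDesD (map (punchInℤ b) (y ∷ ys ++ [ ℓ ]) ++ [ c ]) ≡ finalDes (punchInℤ b ℓ) c + desD (y ∷ ys ++ [ ℓ ])
affDesD-extend b y ys ℓ c =
  trans (cong₂ _+_ (desD-extend b y ys ℓ c) (cong ind lastTwo))
        (xy∙z≈xz∙y (ind ⌊ c ℤ.<? punchInℤ b ℓ ⌋) (desD (y ∷ ys ++ [ ℓ ])) _)
  where
  lastTwo : lastTwoSumPos (map (punchInℤ b) (y ∷ ys ++ [ ℓ ]) ++ [ c ]) ≡ ⌊ ℤ.+ 0 ℤ.<? punchInℤ b ℓ ℤ.+ c ⌋
  lastTwo = trans (cong lastTwoSumPos (map-++-snoc (punchInℤ b) y ys ℓ c))
                  (lastTwoSumPos-++ (punchInℤ b y ∷ map (punchInℤ b) ys) (punchInℤ b ℓ) c)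

finalDes± : ℕ → ℤ → ℕ
finalDes± b s = ind (ℤ.+ suc b <ℤᵇ s) + ind (-[1+ b ] <ℤᵇ s)

finalDes-+ : (b : ℕ) (s : ℤ) → finalDes s (ℤ.+ suc b) ≡ finalDes± b s
finalDes-+ b s = cong₂ _+_ (cong ind (<?-<ℤᵇ (ℤ.+ suc b) s))
                           (cong ind (trans (⌊0<x+y⌋≡⌊-y<x⌋ s (ℤ.+ suc b)) (<?-<ℤᵇ -[1+ b ] s)))

finalDes-- : (b : ℕ) (s : ℤ) → finalDes s -[1+ b ] ≡ finalDes± b s
finalDes-- b s = trans (cong₂ _+_ (cong ind (<?-<ℤᵇ -[1+ b ] s))
                                  (cong ind (trans (⌊0<x+y⌋≡⌊-y<x⌋ s -[1+ b ]) (<?-<ℤᵇ (ℤ.+ suc b) s))))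
                       (+-comm (ind (-[1+ b ] <ℤᵇ s)) _)

-- Words and signed permutations

∑-signedVals : (n : ℕ) (g : ℤ → ℕ) → ∑ (signedVals n) g ≡ ∑[ i < n ] (g (ℤ.+ suc i) + g -[1+ i ])
∑-signedVals n g = begin
  ∑ (signedVals n) g                                  ≡⟨ ∑-concatMap _ (upTo n) g ⟩
  ∑[ i ∈ upTo n ] (g (ℤ.+ suc i) + (g -[1+ i ] + 0))  ≡⟨ ∑-cong (upTo n) (λ i → cong (g (ℤ.+ suc i) +_) (+-identityʳ _)) ⟩
  ∑[ i ∈ upTo n ] (g (ℤ.+ suc i) + g -[1+ i ])        ≡⟨ ∑-upTo n _ ⟩
  ∑[ i < n ] (g (ℤ.+ suc i) + g -[1+ i ])             ∎

∑-signedVals-punchIn : (n b : ℕ) → b ≤ n → (g : ℤ → ℕ) → g (ℤ.+ suc b) ≡ 0 → g -[1+ b ] ≡ 0 →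
                       ∑ (signedVals (suc n)) g ≡ ∑[ c ∈ signedVals n ] g (punchInℤ b c)
∑-signedVals-punchIn n b b≤n g g+≡0 g-≡0 = begin
  ∑ (signedVals (suc n)) g                                              ≡⟨ ∑-signedVals (suc n) g ⟩
  ∑[ i < suc n ] (g (ℤ.+ suc i) + g -[1+ i ])                           ≡⟨ ∑<-punchIn n b b≤n _ (cong₂ _+_ g+≡0 g-≡0) ⟩
  ∑[ i < n ] (g (ℤ.+ suc (punchIn b i)) + g -[1+ punchIn b i ])         ≡⟨ sym (∑-signedVals n _) ⟩
  ∑[ c ∈ signedVals n ] g (punchInℤ b c)                                ∎

module _ {A : Set} where

  ∑-words-suc : (m : ℕ) (cs : List A) (f : List A → ℕ) →
                ∑ (words (suc m) cs) f ≡ ∑[ c ∈ cs ] ∑[ w ∈ words m cs ] f (c ∷ w)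
  ∑-words-suc m cs f = trans (∑-concatMap _ cs f) (∑-cong cs (λ c → ∑-map (c ∷_) (words m cs) f))

  ∑-words-snoc : (m : ℕ) (cs : List A) (f : List A → ℕ) →
                 ∑ (words (suc m) cs) f ≡ ∑[ v ∈ words m cs ] ∑[ c ∈ cs ] f (v ++ [ c ])
  ∑-words-snoc zero cs f =
    trans (∑-words-suc zero cs f) (trans (∑-cong cs (λ c → +-identityʳ (f [ c ]))) (sym (+-identityʳ _)))
  ∑-words-snoc (suc m) cs f = begin
    ∑ (words (suc (suc m)) cs) f                                       ≡⟨ ∑-words-suc (suc m) cs f ⟩
    ∑[ c ∈ cs ] ∑[ w ∈ words (suc m) cs ] f (c ∷ w)
      ≡⟨ ∑-cong cs (λ c → ∑-words-snoc m cs (λ w → f (c ∷ w))) ⟩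
    ∑[ c ∈ cs ] ∑[ v ∈ words m cs ] ∑[ c′ ∈ cs ] f (c ∷ v ++ [ c′ ])    ≡⟨ sym (∑-words-suc m cs _) ⟩
    ∑[ v ∈ words (suc m) cs ] ∑[ c ∈ cs ] f (v ++ [ c ])               ∎

  ∑-words-cong : (m : ℕ) (cs : List A) {f g : List A → ℕ} →
                 (∀ w → length w ≡ m → f w ≡ g w) → ∑ (words m cs) f ≡ ∑ (words m cs) g
  ∑-words-cong zero    cs eq = cong (_+ 0) (eq [] refl)
  ∑-words-cong (suc m) cs {f} {g} eq = begin
    ∑ (words (suc m) cs) f                    ≡⟨ ∑-words-suc m cs f ⟩
    ∑[ c ∈ cs ] ∑[ w ∈ words m cs ] f (c ∷ w)
      ≡⟨ ∑-cong cs (λ c → ∑-words-cong m cs (λ w ∣w∣ → eq (c ∷ w) (cong suc ∣w∣))) ⟩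
    ∑[ c ∈ cs ] ∑[ w ∈ words m cs ] g (c ∷ w) ≡⟨ sym (∑-words-suc m cs g) ⟩
    ∑ (words (suc m) cs) g                    ∎

hasAbs : ℕ → List ℤ → Bool
hasAbs a []       = false
hasAbs a (z ∷ zs) = (∣ z ∣ ≡ᵇ a) ∨ hasAbs a zs

∑-words-punchIn : (n b : ℕ) → b ≤ n → (m : ℕ) (f : List ℤ → ℕ) → (∀ w → hasAbs (suc b) w ≡ true → f w ≡ 0) →
                  ∑ (words m (signedVals (suc n))) f ≡ ∑[ w ∈ words m (signedVals n) ] f (map (punchInℤ b) w)
∑-words-punchIn n b b≤n zero    f f≡0 = refl
∑-words-punchIn n b b≤n (suc m) f f≡0 = begin
  ∑ (words (suc m) (signedVals (suc n))) f
    ≡⟨ ∑-words-suc m _ f ⟩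
  ∑[ c ∈ signedVals (suc n) ] ∑[ w ∈ words m (signedVals (suc n)) ] f (c ∷ w)
    ≡⟨ ∑-cong (signedVals (suc n)) (λ c → ∑-words-punchIn n b b≤n m (λ w → f (c ∷ w))
         (λ w h → f≡0 (c ∷ w) (trans (cong ((∣ c ∣ ≡ᵇ suc b) ∨_) h) (∨-zeroʳ _)))) ⟩
  ∑[ c ∈ signedVals (suc n) ] g c
    ≡⟨ ∑-signedVals-punchIn n b b≤n g (g≡0 (ℤ.+ suc b) (≡ᵇ-refl b)) (g≡0 -[1+ b ] (≡ᵇ-refl b)) ⟩
  ∑[ c ∈ signedVals n ] g (punchInℤ b c)
    ≡⟨ sym (∑-words-suc m (signedVals n) (λ w → f (map (punchInℤ b) w))) ⟩
  ∑[ w ∈ words (suc m) (signedVals n) ] f (map (punchInℤ b) w) ∎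
  where
  g : ℤ → ℕ
  g c = ∑[ w ∈ words m (signedVals n) ] f (c ∷ map (punchInℤ b) w)
  g≡0 : (c : ℤ) → (∣ c ∣ ≡ᵇ suc b) ≡ true → g c ≡ 0
  g≡0 c c≟b = ∑-zero (words m (signedVals n)) _ (λ w → f≡0 _ (cong (_∨ hasAbs (suc b) (map (punchInℤ b) w)) c≟b))

punchInAbs : ℕ → ℕ → ℕ
punchInAbs b zero    = zero
punchInAbs b (suc i) = suc (punchIn b i)

∣punchInℤ∣ : (b : ℕ) (z : ℤ) → ∣ punchInℤ b z ∣ ≡ punchInAbs b ∣ z ∣
∣punchInℤ∣ b (ℤ.+ zero)  = refl
∣punchInℤ∣ b (ℤ.+ suc i) = refl
∣punchInℤ∣ b -[1+ i ]    = refl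

punchInAbs-≡ᵇ : (b x y : ℕ) → (punchInAbs b x ≡ᵇ punchInAbs b y) ≡ (x ≡ᵇ y)
punchInAbs-≡ᵇ b zero    zero    = refl
punchInAbs-≡ᵇ b zero    (suc y) = refl
punchInAbs-≡ᵇ b (suc x) zero    = refl
punchInAbs-≡ᵇ b (suc x) (suc y) = punchIn-≡ᵇ b x y

elemℕ-here : ∀ x y ys → (x ≡ᵇ y) ≡ true → elemℕ x (y ∷ ys) ≡ true
elemℕ-here x y ys eq rewrite eq = refl

elemℕ-there : ∀ x y ys → (x ≡ᵇ y) ≡ false → elemℕ x (y ∷ ys) ≡ elemℕ x ys
elemℕ-there x y ys eq rewrite eq = refl

elemℕ-punchInAbs : (b x : ℕ) (ns : List ℕ) →
                   elemℕ (punchInAbs b x) (map (punchInAbs b) ns ++ [ suc b ]) ≡ elemℕ x ns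
elemℕ-punchInAbs b zero    [] = refl
elemℕ-punchInAbs b (suc x) [] = elemℕ-there (suc (punchIn b x)) (suc b) [] (punchIn-≢ b x)
elemℕ-punchInAbs b x (y ∷ ns) with x ≡ᵇ y in x≟y
... | true  = elemℕ-here (punchInAbs b x) (punchInAbs b y) (map (punchInAbs b) ns ++ [ suc b ]) (trans (punchInAbs-≡ᵇ b x y) x≟y)
... | false = trans (elemℕ-there (punchInAbs b x) (punchInAbs b y) (map (punchInAbs b) ns ++ [ suc b ]) (trans (punchInAbs-≡ᵇ b x y) x≟y))
                    (elemℕ-punchInAbs b x ns)

distinct-punchInAbs : (b : ℕ) (ns : List ℕ) → distinct (map (punchInAbs b) ns ++ [ suc b ]) ≡ distinct ns
distinct-punchInAbs b []       = refl
distinct-punchInAbs b (x ∷ ns) = cong₂ (λ u v → not u ∧ v) (elemℕ-punchInAbs b x ns) (distinct-punchInAbs b ns)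

isSignedPerm-punchInℤ : (b : ℕ) (c : ℤ) → ∣ c ∣ ≡ suc b → (w : List ℤ) →
                        isSignedPerm (map (punchInℤ b) w ++ [ c ]) ≡ isSignedPerm w
isSignedPerm-punchInℤ b c ∣c∣ w = trans (cong distinct (abs-map w)) (distinct-punchInAbs b (map ∣_∣ w))
  where
  abs-map : (w : List ℤ) → map ∣_∣ (map (punchInℤ b) w ++ [ c ]) ≡ map (punchInAbs b) (map ∣_∣ w) ++ [ suc b ]
  abs-map []      = cong [_] ∣c∣
  abs-map (z ∷ w) = cong₂ _∷_ (∣punchInℤ∣ b z) (abs-map w)

elemℕ-snoc : ∀ {x y} ys → (x ≡ᵇ y) ≡ true → elemℕ x (ys ++ [ y ]) ≡ true
elemℕ-snoc {x} {y} []   eq = elemℕ-here x y [] eq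
elemℕ-snoc {x} (z ∷ zs) eq with x ≡ᵇ z in x≟z
... | true  = refl
... | false = elemℕ-snoc zs eq

isSignedPerm-hasAbs : (b : ℕ) (c : ℤ) → ∣ c ∣ ≡ suc b → (v : List ℤ) → hasAbs (suc b) v ≡ true →
                      isSignedPerm (v ++ [ c ]) ≡ false
isSignedPerm-hasAbs b c ∣c∣ (z ∷ v) h with ∣ z ∣ ≡ᵇ suc b in z≟c
... | true  = cong (λ t → not t ∧ distinct (map ∣_∣ (v ++ [ c ])))
                   (trans (cong (elemℕ ∣ z ∣) (map-++ ∣_∣ v [ c ]))
                          (elemℕ-snoc (map ∣_∣ v) (trans (cong (∣ z ∣ ≡ᵇ_) ∣c∣) z≟c)))
... | false = trans (cong (not (elemℕ ∣ z ∣ (map ∣_∣ (v ++ [ c ]))) ∧_) (isSignedPerm-hasAbs b c ∣c∣ v h)) (∧-zeroʳ _)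

∑-signedPerm-snoc : (n m b : ℕ) → b ≤ n → (c : ℤ) → ∣ c ∣ ≡ suc b → (F : List ℤ → ℕ) →
                    ∑[ v ∈ words m (signedVals (suc n)) ] (ind (isSignedPerm (v ++ [ c ])) * F (v ++ [ c ]))
                    ≡ ∑[ u ∈ words m (signedVals n) ] (ind (isSignedPerm u) * F (map (punchInℤ b) u ++ [ c ]))
∑-signedPerm-snoc n m b b≤n c ∣c∣ F = trans
  (∑-words-punchIn n b b≤n m _ (λ w h → cong (λ t → ind t * F (w ++ [ c ])) (isSignedPerm-hasAbs b c ∣c∣ w h)))
  (∑-cong (words m (signedVals n)) (λ u →
    cong (λ t → ind t * F (map (punchInℤ b) u ++ [ c ])) (isSignedPerm-punchInℤ b c ∣c∣ u)))

-- Decomposing D̃_n by the last letter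

endingIn : ℕ → ℤ → Poly
endingIn p c k = ∑[ v ∈ words p (signedVals (suc p)) ] (ind (isSignedPerm (v ++ [ c ])) * mono (desD (v ++ [ c ])) k)

affineWeight : ℕ → List ℤ → ℕ
affineWeight k w = ind (isEven (negCount w)) * mono (affDesD w) k

affineEulerianD-∑words : (n k : ℕ) →
  affineEulerianD n k ≡ ∑[ w ∈ words n (signedVals n) ] (ind (isSignedPerm w) * affineWeight k w)
affineEulerianD-∑words n k = begin
  affineEulerianD n k                                      ≡⟨ genPoly-∑ (Dn n) affDesD k ⟩
  ∑[ σ ∈ Dn n ] mono (affDesD σ) k                          ≡⟨ ∑-filter (λ σ → isEven (negCount σ)) (signedPerms n) _ ⟩
  ∑[ σ ∈ signedPerms n ] affineWeight k σ                   ≡⟨ ∑-filter isSignedPerm (words n (signedVals n)) _ ⟩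
  ∑[ w ∈ words n (signedVals n) ] (ind (isSignedPerm w) * affineWeight k w) ∎

-- The two signs of the last letter give the same number of affine descents and opposite parities.
affineWeight-± : (k b : ℕ) (y : ℤ) (ys : List ℤ) (ℓ : ℤ) →
  let u = y ∷ ys ++ [ ℓ ] in
  affineWeight k (map (punchInℤ b) u ++ [ ℤ.+ suc b ]) + affineWeight k (map (punchInℤ b) u ++ [ -[1+ b ] ])
  ≡ mono (finalDes± b (punchInℤ b ℓ) + desD u) k
affineWeight-± k b y ys ℓ = begin
  affineWeight k (ext (ℤ.+ suc b)) + affineWeight k (ext -[1+ b ])
    ≡⟨ cong₂ _+_ (cong₂ (λ n d → ind (isEven n) * mono d k) (negCount-ext (ℤ.+ suc b)) (affDes-ext (ℤ.+ suc b) (finalDes-+ b s)))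
                 (cong₂ (λ n d → ind (isEven n) * mono d k) (negCount-ext -[1+ b ]) (affDes-ext -[1+ b ] (finalDes-- b s))) ⟩
  ind (isEven (N + 0)) * M + ind (isEven (N + 1)) * M
    ≡⟨ sym (*-distribʳ-+ M (ind (isEven (N + 0))) _) ⟩
  (ind (isEven (N + 0)) + ind (isEven (N + 1))) * M
    ≡⟨ cong₂ (λ a b → (ind (isEven a) + ind (isEven b)) * M) (+-identityʳ N) (+-comm N 1) ⟩
  (ind (isEven N) + ind (isEven (suc N))) * M
    ≡⟨ cong (_* M) (ind-isEven+ind-isEven-suc N) ⟩
  1 * M                                              ≡⟨ *-identityˡ M ⟩
  M                                                  ∎
  where
  u = y ∷ ys ++ [ ℓ ]
  s = punchInℤ b ℓ
  N = negCount u
  M = mono (finalDes± b s + desD u) k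
  ext : ℤ → List ℤ
  ext c = map (punchInℤ b) u ++ [ c ]
  negCount-ext : (c : ℤ) → negCount (ext c) ≡ N + (ind (c <ℤᵇ ℤ.+ 0) + 0)
  negCount-ext c = trans (negCount-++ (map (punchInℤ b) u) [ c ])
                         (cong₂ (λ a t → a + (ind t + 0)) (negCount-punchInℤ b u) (<?-<ℤᵇ c (ℤ.+ 0)))
  affDes-ext : (c : ℤ) → finalDes s c ≡ finalDes± b s → affDesD (ext c) ≡ finalDes± b s + desD u
  affDes-ext c eq = trans (affDesD-extend b y ys ℓ c) (cong (_+ desD u) eq)

∑-affineWeight-snoc± : (q k b : ℕ) → b ≤ suc (suc q) →
  let m = suc (suc q) ; n = suc m
      ∑ext : ℤ → ℕ
      ∑ext c = ∑[ v ∈ words m (signedVals n) ] (ind (isSignedPerm (v ++ [ c ])) * affineWeight k (v ++ [ c ]))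
  in ∑ext (ℤ.+ suc b) + ∑ext -[1+ b ] ≡ ∑[ ℓ ∈ signedVals m ] (x^ finalDes± b (punchInℤ b ℓ) · endingIn (suc q) ℓ) k
∑-affineWeight-snoc± q k b b≤m = begin
  ∑[ v ∈ words m (signedVals n) ] (ind (isSignedPerm (v ++ [ ℤ.+ suc b ])) * affineWeight k (v ++ [ ℤ.+ suc b ]))
  + ∑[ v ∈ words m (signedVals n) ] (ind (isSignedPerm (v ++ [ -[1+ b ] ])) * affineWeight k (v ++ [ -[1+ b ] ]))
    ≡⟨ cong₂ _+_ (∑-signedPerm-snoc m m b b≤m (ℤ.+ suc b) refl (affineWeight k))
                 (∑-signedPerm-snoc m m b b≤m -[1+ b ] refl (affineWeight k)) ⟩
  ∑[ u ∈ words m (signedVals m) ] (ind (isSignedPerm u) * W⁺ u) + ∑[ u ∈ words m (signedVals m) ] (ind (isSignedPerm u) * W⁻ u)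
    ≡⟨ sym (∑-+ (words m (signedVals m)) _ _) ⟩
  ∑[ u ∈ words m (signedVals m) ] (ind (isSignedPerm u) * W⁺ u + ind (isSignedPerm u) * W⁻ u)
    ≡⟨ ∑-cong (words m (signedVals m)) (λ u → sym (*-distribˡ-+ (ind (isSignedPerm u)) (W⁺ u) (W⁻ u))) ⟩
  ∑[ u ∈ words m (signedVals m) ] (ind (isSignedPerm u) * (W⁺ u + W⁻ u))
    ≡⟨ ∑-words-snoc m′ (signedVals m) _ ⟩
  ∑[ u ∈ words m′ (signedVals m) ] ∑[ ℓ ∈ signedVals m ] (ind (isSignedPerm (u ++ [ ℓ ])) * (W⁺ (u ++ [ ℓ ]) + W⁻ (u ++ [ ℓ ])))
    ≡⟨ ∑-words-cong m′ (signedVals m) (λ { (y ∷ ys) _ → ∑-cong (signedVals m) (λ ℓ →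
         cong (ind (isSignedPerm (y ∷ ys ++ [ ℓ ])) *_) (affineWeight-± k b y ys ℓ)) }) ⟩
  ∑[ u ∈ words m′ (signedVals m) ] ∑[ ℓ ∈ signedVals m ] (ind (isSignedPerm (u ++ [ ℓ ])) * mono (E ℓ + desD (u ++ [ ℓ ])) k)
    ≡⟨ ∑-comm (words m′ (signedVals m)) (signedVals m) _ ⟩
  ∑[ ℓ ∈ signedVals m ] ∑[ u ∈ words m′ (signedVals m) ] (ind (isSignedPerm (u ++ [ ℓ ])) * mono (E ℓ + desD (u ++ [ ℓ ])) k)
    ≡⟨ ∑-cong (signedVals m) (λ ℓ → ∑-*-mono-+ (words m′ (signedVals m)) (E ℓ)
                                       (λ u → ind (isSignedPerm (u ++ [ ℓ ]))) (λ u → desD (u ++ [ ℓ ])) k) ⟩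
  ∑[ ℓ ∈ signedVals m ] (x^ E ℓ · endingIn m′ ℓ) k ∎
  where
  m′ = suc q
  m = suc m′
  n = suc m
  W⁺ W⁻ : List ℤ → ℕ
  W⁺ u = affineWeight k (map (punchInℤ b) u ++ [ ℤ.+ suc b ])
  W⁻ u = affineWeight k (map (punchInℤ b) u ++ [ -[1+ b ] ])
  E : ℤ → ℕ
  E ℓ = finalDes± b (punchInℤ b ℓ)

affineEulerianD-∑finalDes± : (q k : ℕ) → let m = suc (suc q) in
  affineEulerianD (suc m) k ≡ ∑[ ℓ ∈ signedVals m ] ∑[ b < suc m ] (x^ finalDes± b (punchInℤ b ℓ) · endingIn (suc q) ℓ) k
affineEulerianD-∑finalDes± q k = begin
  affineEulerianD n k
    ≡⟨ affineEulerianD-∑words n k ⟩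
  ∑[ w ∈ words n (signedVals n) ] Φ w
    ≡⟨ ∑-words-snoc m (signedVals n) Φ ⟩
  ∑[ v ∈ words m (signedVals n) ] ∑[ c ∈ signedVals n ] Φ (v ++ [ c ])
    ≡⟨ ∑-comm (words m (signedVals n)) (signedVals n) (λ v c → Φ (v ++ [ c ])) ⟩
  ∑[ c ∈ signedVals n ] ∑[ v ∈ words m (signedVals n) ] Φ (v ++ [ c ])
    ≡⟨ ∑-signedVals n (λ c → ∑[ v ∈ words m (signedVals n) ] Φ (v ++ [ c ])) ⟩
  ∑[ b < n ] (∑[ v ∈ words m (signedVals n) ] Φ (v ++ [ ℤ.+ suc b ]) + ∑[ v ∈ words m (signedVals n) ] Φ (v ++ [ -[1+ b ] ]))
    ≡⟨ ∑<-cong n (λ b b<n → ∑-affineWeight-snoc± q k b (s≤s⁻¹ b<n)) ⟩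
  ∑[ b < n ] ∑[ ℓ ∈ signedVals m ] (x^ finalDes± b (punchInℤ b ℓ) · endingIn (suc q) ℓ) k
    ≡⟨ ∑<-comm∑ n (signedVals m) _ ⟩
  ∑[ ℓ ∈ signedVals m ] ∑[ b < n ] (x^ finalDes± b (punchInℤ b ℓ) · endingIn (suc q) ℓ) k ∎
  where
  m = suc (suc q)
  n = suc m
  Φ : List ℤ → ℕ
  Φ w = ind (isSignedPerm w) * affineWeight k w

∑<-x^finalDes±-+ : (n i : ℕ) → i < n → (p : Poly) →
  (λ k → ∑[ b < n ] (x^ finalDes± b (punchInℤ b (ℤ.+ suc i)) · p) k) ≗ (λ k → suc i * (x^ 2 · p) k + (n ∸ suc i) * (x^ 1 · p) k)
∑<-x^finalDes±-+ n i i<n p k = ∑<-twoValued n i _ _ _ i<n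
  (λ b b≤i → cong (λ e → (x^ e · p) k) (two b≤i)) (λ b i<b → cong (λ e → (x^ e · p) k) (one i<b))
  where
  two : ∀ {b} → b ≤ i → finalDes± b (punchInℤ b (ℤ.+ suc i)) ≡ 2
  two {b} b≤i rewrite punchIn-≥ b≤i | <⇒<ᵇ-true (s≤s b≤i) = refl
  one : ∀ {b} → i < b → finalDes± b (punchInℤ b (ℤ.+ suc i)) ≡ 1
  one {b} i<b rewrite punchIn-< i<b | ≥⇒<ᵇ-false (<⇒≤ i<b) = refl

∑<-x^finalDes±-- : (n i : ℕ) → i < n → (p : Poly) →
  (λ k → ∑[ b < n ] (x^ finalDes± b (punchInℤ b -[1+ i ]) · p) k) ≗ (λ k → suc i * p k + (n ∸ suc i) * (x^ 1 · p) k)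
∑<-x^finalDes±-- n i i<n p k = ∑<-twoValued n i _ _ _ i<n
  (λ b b≤i → cong (λ e → (x^ e · p) k) (none b≤i)) (λ b i<b → cong (λ e → (x^ e · p) k) (one i<b))
  where
  none : ∀ {b} → b ≤ i → finalDes± b (punchInℤ b -[1+ i ]) ≡ 0
  none {b} b≤i rewrite punchIn-≥ b≤i | ≥⇒<ᵇ-false (m≤n⇒m≤1+n b≤i) = refl
  one : ∀ {b} → i < b → finalDes± b (punchInℤ b -[1+ i ]) ≡ 1
  one {b} i<b rewrite punchIn-< i<b | <⇒<ᵇ-true i<b = refl

-- Recurrences in the last letter

endingIn-recurrence : (p b : ℕ) (c : ℤ) → ∣ c ∣ ≡ suc b → b ≤ suc (suc p) →
  endingIn (suc (suc p)) c ≗ (λ k → ∑[ ℓ ∈ signedVals (suc (suc p)) ] (x^ ind (c <ℤᵇ punchInℤ b ℓ) · endingIn (suc p) ℓ) k)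
endingIn-recurrence p b c ∣c∣ b≤ k = begin
  endingIn m c k
    ≡⟨ ∑-signedPerm-snoc m m b b≤ c ∣c∣ (λ w → mono (desD w) k) ⟩
  ∑[ u ∈ words m (signedVals m) ] (ind (isSignedPerm u) * mono (desD (map (punchInℤ b) u ++ [ c ])) k)
    ≡⟨ ∑-words-snoc m′ (signedVals m) _ ⟩
  ∑[ u ∈ words m′ (signedVals m) ] ∑[ ℓ ∈ signedVals m ]
    (ind (isSignedPerm (u ++ [ ℓ ])) * mono (desD (map (punchInℤ b) (u ++ [ ℓ ]) ++ [ c ])) k)
    ≡⟨ ∑-words-cong m′ (signedVals m) (λ { (y ∷ ys) _ → ∑-cong (signedVals m) (λ ℓ →
         cong (λ d → ind (isSignedPerm (y ∷ ys ++ [ ℓ ])) * mono d k)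
              (trans (desD-extend b y ys ℓ c) (cong (λ t → ind t + desD (y ∷ ys ++ [ ℓ ])) (<?-<ℤᵇ c (punchInℤ b ℓ))))) }) ⟩
  ∑[ u ∈ words m′ (signedVals m) ] ∑[ ℓ ∈ signedVals m ] (ind (isSignedPerm (u ++ [ ℓ ])) * mono (E ℓ + desD (u ++ [ ℓ ])) k)
    ≡⟨ ∑-comm (words m′ (signedVals m)) (signedVals m) _ ⟩
  ∑[ ℓ ∈ signedVals m ] ∑[ u ∈ words m′ (signedVals m) ] (ind (isSignedPerm (u ++ [ ℓ ])) * mono (E ℓ + desD (u ++ [ ℓ ])) k)
    ≡⟨ ∑-cong (signedVals m) (λ ℓ → ∑-*-mono-+ (words m′ (signedVals m)) (E ℓ)
                                       (λ u → ind (isSignedPerm (u ++ [ ℓ ]))) (λ u → desD (u ++ [ ℓ ])) k) ⟩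
  ∑[ ℓ ∈ signedVals m ] (x^ E ℓ · endingIn m′ ℓ) k ∎
  where
  m′ = suc p
  m = suc m′
  E : ℤ → ℕ
  E ℓ = ind (c <ℤᵇ punchInℤ b ℓ)

last₀ : List ℕ → ℕ
last₀ []          = 0
last₀ (a ∷ [])    = a
last₀ (a ∷ b ∷ r) = last₀ (b ∷ r)

last₀-snoc : (e : List ℕ) (t : ℕ) → last₀ (snoc e t) ≡ t
last₀-snoc []          t = refl
last₀-snoc (a ∷ [])    t = refl
last₀-snoc (a ∷ b ∷ r) t = last₀-snoc (b ∷ r) t

lastIs-snoc : (i : ℕ) (e : List ℕ) (t : ℕ) → lastIs i (snoc e t) ≡ (t ≡ᵇ i)
lastIs-snoc i []          t = refl
lastIs-snoc i (a ∷ [])    t = refl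
lastIs-snoc i (a ∷ b ∷ r) t = lastIs-snoc i (b ∷ r) t

length-snoc : (e : List ℕ) (t : ℕ) → length (snoc e t) ≡ suc (length e)
length-snoc []      t = refl
length-snoc (a ∷ e) t = cong suc (length-snoc e t)

∑-Iseq-suc : (m : ℕ) (f : List ℕ → ℕ) → ∑ (Iseq (suc m)) f ≡ ∑[ e ∈ Iseq m ] ∑[ t < 2 * suc m ] f (snoc e t)
∑-Iseq-suc m f = trans (∑-concatMap _ (Iseq m) f)
  (∑-cong (Iseq m) (λ e → trans (∑-map (snoc e) (upTo (2 * suc m)) f) (∑-upTo (2 * suc m) (λ t → f (snoc e t)))))

∑-Iseq-cong : (m : ℕ) {f g : List ℕ → ℕ} → (∀ e → length e ≡ m → f e ≡ g e) → ∑ (Iseq m) f ≡ ∑ (Iseq m) g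
∑-Iseq-cong zero    eq = cong (_+ 0) (eq [] refl)
∑-Iseq-cong (suc m) {f} {g} eq = begin
  ∑ (Iseq (suc m)) f                             ≡⟨ ∑-Iseq-suc m f ⟩
  ∑[ e ∈ Iseq m ] ∑[ t < 2 * suc m ] f (snoc e t) ≡⟨ ∑-Iseq-cong m (λ e ∣e∣ → ∑<-cong (2 * suc m) (λ t _ →
                                                        eq (snoc e t) (trans (length-snoc e t) (cong suc ∣e∣)))) ⟩
  ∑[ e ∈ Iseq m ] ∑[ t < 2 * suc m ] g (snoc e t) ≡⟨ sym (∑-Iseq-suc m g) ⟩
  ∑ (Iseq (suc m)) g                             ∎

ascFrom-snoc : (k a : ℕ) (r : List ℕ) (t : ℕ) →
  ascFrom k (snoc (a ∷ r) t) ≡ ascFrom k (a ∷ r) + ind (last₀ (a ∷ r) * suc (k + length r) <ᵇ t * (k + length r))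
ascFrom-snoc k a []      t rewrite +-identityʳ k = +-comm (ind (a * suc k <ᵇ t * k)) 0
ascFrom-snoc k a (b ∷ r) t rewrite +-suc k (length r) =
  trans (cong (ind (a * suc k <ᵇ b * k) +_) (ascFrom-snoc (suc k) b r t)) (sym (+-assoc (ind (a * suc k <ᵇ b * k)) _ _))

ascD-snoc : (e : List ℕ) (m t : ℕ) → length e ≡ suc (suc m) →
            ascD (snoc e t) ≡ ind (last₀ e * suc (suc (suc m)) <ᵇ t * suc (suc m)) + ascD e
ascD-snoc (a ∷ b ∷ r) m t refl =
  trans (cong (ind (zeroAsc (a ∷ b ∷ r)) +_) (ascFrom-snoc 1 a (b ∷ r) t))
        (x∙yz≈z∙xy (ind (zeroAsc (a ∷ b ∷ r))) (ascFrom 1 (a ∷ b ∷ r)) _)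

T-snoc : (m i : ℕ) → i < 2 * suc m → T (suc m) i ≗ (λ k → ∑[ e ∈ Iseq m ] mono (ascD (snoc e i)) k)
T-snoc m i i< k = begin
  T (suc m) i k
    ≡⟨ genPoly-∑ (filter (λ e → lastIs i e Data.Bool.≟ true) (Iseq (suc m))) ascD k ⟩
  ∑ (filter (λ e → lastIs i e Data.Bool.≟ true) (Iseq (suc m))) (λ e → mono (ascD e) k)
    ≡⟨ ∑-filter (lastIs i) (Iseq (suc m)) _ ⟩
  ∑[ e ∈ Iseq (suc m) ] (ind (lastIs i e) * mono (ascD e) k)
    ≡⟨ ∑-Iseq-suc m _ ⟩
  ∑[ e ∈ Iseq m ] ∑[ t < 2 * suc m ] (ind (lastIs i (snoc e t)) * mono (ascD (snoc e t)) k)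
    ≡⟨ ∑-cong (Iseq m) (λ e → trans (∑<-cong (2 * suc m) (λ t _ →
                                       cong (λ x → ind x * mono (ascD (snoc e t)) k) (lastIs-snoc i e t)))
                                     (∑<-pick (2 * suc m) i (λ t → mono (ascD (snoc e t)) k) i<)) ⟩
  ∑[ e ∈ Iseq m ] mono (ascD (snoc e i)) k ∎

T-recurrence : (r j : ℕ) → j < 2 * suc (suc (suc r)) →
  T (suc (suc (suc r))) j ≗ (λ k → ∑[ t < 2 * suc (suc r) ] (x^ ind (t * suc (suc (suc r)) <ᵇ j * suc (suc r)) · T (suc (suc r)) t) k)
T-recurrence r j j< k = begin
  T (suc m) j k
    ≡⟨ T-snoc m j j< k ⟩
  ∑[ e ∈ Iseq m ] mono (ascD (snoc e j)) k
    ≡⟨ ∑-Iseq-cong m (λ e ∣e∣ → cong (λ d → mono d k) (ascD-snoc e r j ∣e∣)) ⟩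
  ∑[ e ∈ Iseq m ] mono (ind (last₀ e * suc m <ᵇ j * m) + ascD e) k
    ≡⟨ ∑-Iseq-suc m′ _ ⟩
  ∑[ e ∈ Iseq m′ ] ∑[ t < 2 * m ] mono (ind (last₀ (snoc e t) * suc m <ᵇ j * m) + ascD (snoc e t)) k
    ≡⟨ ∑-cong (Iseq m′) (λ e → ∑<-cong (2 * m) (λ t _ →
         trans (cong (λ x → mono (ind (x * suc m <ᵇ j * m) + ascD (snoc e t)) k) (last₀-snoc e t))
               (mono-+ (E t) (ascD (snoc e t)) k))) ⟩
  ∑[ e ∈ Iseq m′ ] ∑[ t < 2 * m ] (x^ E t · mono (ascD (snoc e t))) k
    ≡⟨ sym (∑<-comm∑ (2 * m) (Iseq m′) _) ⟩
  ∑[ t < 2 * m ] ∑[ e ∈ Iseq m′ ] (x^ E t · mono (ascD (snoc e t))) k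
    ≡⟨ ∑<-cong (2 * m) (λ t t< → trans (sym (x^·-∑ (Iseq m′) (E t) (λ e → mono (ascD (snoc e t))) k))
                                       (x^·-cong (E t) (λ k′ → sym (T-snoc m′ t t< k′)) k)) ⟩
  ∑[ t < 2 * m ] (x^ E t · T m t) k ∎
  where
  m′ = suc r
  m = suc m′
  E : ℕ → ℕ
  E t = ind (t * suc m <ᵇ j * m)

-- For c = ±(b+1) and ℓ = ±(i+1), the descent c < ℓ at the end of a signed permutation of [m+1]
-- is the ascent e_m/m < e_{m+1}/(m+1) between the entries corresponding to ℓ and c, where the
-- letter +(i+1) of a signed permutation of [m] corresponds to the entry m−1−i, and −(i+1) to m+i.

X*[1+m]<[1+X]*m : (X m : ℕ) → X < m → X * suc m < suc X * m
X*[1+m]<[1+X]*m X m X<m = subst (_< suc X * m) (sym (*-suc X m)) (+-monoˡ-< (X * m) X<m)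

m∸[1+i]<m : (m i : ℕ) → i < m → m ∸ suc i < m
m∸[1+i]<m m i i<m = ∸-monoʳ-< {m} {suc i} {0} (s≤s z≤n) i<m

descent≡ascent-++ : (m b i : ℕ) → i < m →
  (ℤ.+ suc b <ℤᵇ punchInℤ b (ℤ.+ suc i)) ≡ ((m ∸ suc i) * suc m <ᵇ (suc m ∸ suc b) * m)
descent≡ascent-++ m b i i<m with i <? b
... | yes i<b rewrite punchIn-< i<b = trans (≥⇒<ᵇ-false (<⇒≤ i<b)) (sym (≥⇒<ᵇ-false ascent-fails))
  where
  ascent-fails : (m ∸ b) * m ≤ (m ∸ suc i) * suc m
  ascent-fails = ≤-trans (*-monoˡ-≤ m (∸-monoʳ-≤ m i<b)) (*-monoʳ-≤ (m ∸ suc i) (n≤1+n m))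
... | no i≮b rewrite punchIn-≥ (≮⇒≥ i≮b) = trans (<⇒<ᵇ-true (s≤s (≮⇒≥ i≮b))) (sym (<⇒<ᵇ-true ascent))
  where
  ascent : (m ∸ suc i) * suc m < (m ∸ b) * m
  ascent = <-≤-trans (X*[1+m]<[1+X]*m (m ∸ suc i) m (m∸[1+i]<m m i i<m))
                     (*-monoˡ-≤ m (subst (_≤ m ∸ b) (+-∸-assoc 1 i<m) (∸-monoʳ-≤ m (≮⇒≥ i≮b))))

descent≡ascent-+- : (m b i : ℕ) →
  (ℤ.+ suc b <ℤᵇ punchInℤ b -[1+ i ]) ≡ ((m + i) * suc m <ᵇ (suc m ∸ suc b) * m)
descent≡ascent-+- m b i = sym (≥⇒<ᵇ-false ascent-fails)
  where
  ascent-fails : (m ∸ b) * m ≤ (m + i) * suc m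
  ascent-fails = ≤-trans (*-monoˡ-≤ m (≤-trans (m∸n≤m m b) (m≤m+n m i))) (*-monoʳ-≤ (m + i) (n≤1+n m))

descent≡ascent--+ : (m b i : ℕ) → i < m →
  (-[1+ b ] <ℤᵇ punchInℤ b (ℤ.+ suc i)) ≡ ((m ∸ suc i) * suc m <ᵇ (suc m + b) * m)
descent≡ascent--+ m b i i<m = sym (<⇒<ᵇ-true ascent)
  where
  ascent : (m ∸ suc i) * suc m < (suc m + b) * m
  ascent = <-≤-trans (X*[1+m]<[1+X]*m (m ∸ suc i) m (m∸[1+i]<m m i i<m))
                     (*-monoˡ-≤ m (≤-trans (m∸[1+i]<m m i i<m) (≤-trans (n≤1+n m) (m≤m+n (suc m) b))))

[m+i]*[1+m] : (m i : ℕ) → (m + i) * suc m ≡ (m * m + m) + (i + i * m)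
[m+i]*[1+m] = solve 2 (λ m i → (m :+ i) :* (con 1 :+ m) := (m :* m :+ m) :+ (i :+ i :* m)) refl

[1+m+b]*m : (m b : ℕ) → (suc m + b) * m ≡ (m * m + m) + b * m
[1+m+b]*m = solve 2 (λ m b → (con 1 :+ m :+ b) :* m := (m :* m :+ m) :+ b :* m) refl

descent≡ascent--- : (m b i : ℕ) → i < m →
  (-[1+ b ] <ℤᵇ punchInℤ b -[1+ i ]) ≡ ((m + i) * suc m <ᵇ (suc m + b) * m)
descent≡ascent--- m b i i<m with i <? b
... | yes i<b rewrite punchIn-< i<b = trans (<⇒<ᵇ-true i<b) (sym (<⇒<ᵇ-true ascent))
  where
  ascent : (m + i) * suc m < (suc m + b) * m
  ascent = subst₂ _<_ (sym ([m+i]*[1+m] m i)) (sym ([1+m+b]*m m b))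
    (+-monoʳ-< (m * m + m) (<-≤-trans (+-monoˡ-< (i * m) i<m) (*-monoˡ-≤ m i<b)))
... | no i≮b rewrite punchIn-≥ (≮⇒≥ i≮b) = trans (≥⇒<ᵇ-false (m≤n⇒m≤1+n (≮⇒≥ i≮b))) (sym (≥⇒<ᵇ-false ascent-fails))
  where
  ascent-fails : (suc m + b) * m ≤ (m + i) * suc m
  ascent-fails = subst₂ _≤_ (sym ([1+m+b]*m m b)) (sym ([m+i]*[1+m] m i))
    (+-monoʳ-≤ (m * m + m) (≤-trans (*-monoˡ-≤ m (≮⇒≥ i≮b)) (m≤n+m (i * m) i)))

EndingIn≗T : ℕ → Set
EndingIn≗T q = ∀ i → i < suc (suc q) →
  (endingIn (suc q) (ℤ.+ suc i) ≗ T (suc (suc q)) (suc (suc q) ∸ suc i)) ×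
  (endingIn (suc q) -[1+ i ] ≗ T (suc (suc q)) (suc (suc q) + i))

endingIn≗T-step : (q b : ℕ) (c : ℤ) (j : ℕ) → ∣ c ∣ ≡ suc b → b ≤ suc (suc q) → j < 2 * suc (suc (suc q)) →
  EndingIn≗T q →
  (∀ i → i < suc (suc q) → (c <ℤᵇ punchInℤ b (ℤ.+ suc i)) ≡ ((suc (suc q) ∸ suc i) * suc (suc (suc q)) <ᵇ j * suc (suc q))) →
  (∀ i → i < suc (suc q) → (c <ℤᵇ punchInℤ b -[1+ i ]) ≡ ((suc (suc q) + i) * suc (suc (suc q)) <ᵇ j * suc (suc q))) →
  endingIn (suc (suc q)) c ≗ T (suc (suc (suc q))) j
endingIn≗T-step q b c j ∣c∣ b≤m j< IH desc⁺ desc⁻ k = begin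
  endingIn m c k
    ≡⟨ endingIn-recurrence q b c ∣c∣ b≤m k ⟩
  ∑[ ℓ ∈ signedVals m ] (x^ ind (c <ℤᵇ punchInℤ b ℓ) · endingIn (suc q) ℓ) k
    ≡⟨ ∑-signedVals m (λ ℓ → (x^ ind (c <ℤᵇ punchInℤ b ℓ) · endingIn (suc q) ℓ) k) ⟩
  ∑[ i < m ] ((x^ ind (c <ℤᵇ punchInℤ b (ℤ.+ suc i)) · endingIn (suc q) (ℤ.+ suc i)) k
             + (x^ ind (c <ℤᵇ punchInℤ b -[1+ i ]) · endingIn (suc q) -[1+ i ]) k)
    ≡⟨ ∑<-cong m (λ i i<m → cong₂ _+_
         (trans (cong (λ x → (x^ ind x · endingIn (suc q) (ℤ.+ suc i)) k) (desc⁺ i i<m))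
                (x^·-cong (E (m ∸ suc i)) (proj₁ (IH i i<m)) k))
         (trans (cong (λ x → (x^ ind x · endingIn (suc q) -[1+ i ]) k) (desc⁻ i i<m))
                (x^·-cong (E (m + i)) (proj₂ (IH i i<m)) k))) ⟩
  ∑[ i < m ] (f (m ∸ suc i) + f (m + i))          ≡⟨ ∑<-+ m (λ i → f (m ∸ suc i)) (λ i → f (m + i)) ⟩
  ∑[ i < m ] f (m ∸ suc i) + ∑[ i < m ] f (m + i) ≡⟨ cong (_+ ∑[ i < m ] f (m + i)) (sym (∑<-reverse m f)) ⟩
  ∑< m f + ∑[ i < m ] f (m + i)                   ≡⟨ sym (∑<-split m m f) ⟩
  ∑< (m + m) f                                    ≡⟨ cong (λ x → ∑< (m + x) f) (sym (+-identityʳ m)) ⟩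
  ∑< (2 * m) f                                    ≡⟨ sym (T-recurrence q j j< k) ⟩
  T (suc m) j k                                   ∎
  where
  m = suc (suc q)
  E : ℕ → ℕ
  E t = ind (t * suc m <ᵇ j * m)
  f : ℕ → ℕ
  f t = (x^ E t · T m t) k

endingIn≗T : (q : ℕ) → EndingIn≗T q
endingIn≗T zero zero _ = last+1 , last-1
  where
  last+1 : endingIn 1 (ℤ.+ 1) ≗ T 2 1
  last+1 0                   = refl
  last+1 1                   = refl
  last+1 2                   = refl
  last+1 (suc (suc (suc k))) = refl
  last-1 : endingIn 1 -[1+ 0 ] ≗ T 2 2
  last-1 0                   = refl
  last-1 1                   = refl
  last-1 2                   = refl
  last-1 (suc (suc (suc k))) = refl
endingIn≗T zero (suc zero) _ = last+2 , last-2
  where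
  last+2 : endingIn 1 (ℤ.+ 2) ≗ T 2 0
  last+2 0                   = refl
  last+2 1                   = refl
  last+2 2                   = refl
  last+2 (suc (suc (suc k))) = refl
  last-2 : endingIn 1 -[1+ 1 ] ≗ T 2 3
  last-2 0                   = refl
  last-2 1                   = refl
  last-2 2                   = refl
  last-2 (suc (suc (suc k))) = refl
endingIn≗T zero (suc (suc i)) (s≤s (s≤s ()))
endingIn≗T (suc q) i i<m′ =
  endingIn≗T-step q i (ℤ.+ suc i) (suc m ∸ suc i) refl (s≤s⁻¹ i<m′) j⁺< (endingIn≗T q)
                  (λ i′ i′<m → descent≡ascent-++ m i i′ i′<m) (λ i′ _ → descent≡ascent-+- m i i′) ,
  endingIn≗T-step q i -[1+ i ] (suc m + i) refl (s≤s⁻¹ i<m′) j⁻< (endingIn≗T q)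
                  (λ i′ i′<m → descent≡ascent--+ m i i′ i′<m) (λ i′ i′<m → descent≡ascent--- m i i′ i′<m)
  where
  m = suc (suc q)
  j⁺< : suc m ∸ suc i < 2 * suc m
  j⁺< = s≤s (≤-trans (m∸n≤m m i) (m≤m+n m (1 * suc m)))
  j⁻< : suc m + i < 2 * suc m
  j⁻< = subst (suc m + i <_) (cong (suc m +_) (sym (+-identityʳ (suc m)))) (+-monoʳ-< (suc m) i<m′)

-- Both sides of the identity

affineEulerianD-∑endingIn : (q k : ℕ) → let m = suc (suc q) in
  affineEulerianD (suc m) k
  ≡ ∑[ i < m ] (suc i * (x^ 2 · endingIn (suc q) (ℤ.+ suc i)) k + (m ∸ i) * (x^ 1 · endingIn (suc q) (ℤ.+ suc i)) k)
  + ∑[ i < m ] (suc i * endingIn (suc q) -[1+ i ] k + (m ∸ i) * (x^ 1 · endingIn (suc q) -[1+ i ]) k)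
affineEulerianD-∑endingIn q k = begin
  affineEulerianD (suc m) k
    ≡⟨ affineEulerianD-∑finalDes± q k ⟩
  ∑[ ℓ ∈ signedVals m ] S ℓ
    ≡⟨ ∑-signedVals m S ⟩
  ∑[ i < m ] (S (ℤ.+ suc i) + S -[1+ i ])
    ≡⟨ ∑<-cong m (λ i i<m → cong₂ _+_ (∑<-x^finalDes±-+ (suc m) i (m<n⇒m<1+n i<m) (G (ℤ.+ suc i)) k)
                                      (∑<-x^finalDes±-- (suc m) i (m<n⇒m<1+n i<m) (G -[1+ i ]) k)) ⟩
  ∑[ i < m ] ((suc i * (x^ 2 · G (ℤ.+ suc i)) k + (m ∸ i) * (x^ 1 · G (ℤ.+ suc i)) k)
             + (suc i * G -[1+ i ] k + (m ∸ i) * (x^ 1 · G -[1+ i ]) k))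
    ≡⟨ ∑<-+ m _ _ ⟩
  ∑[ i < m ] (suc i * (x^ 2 · G (ℤ.+ suc i)) k + (m ∸ i) * (x^ 1 · G (ℤ.+ suc i)) k)
  + ∑[ i < m ] (suc i * G -[1+ i ] k + (m ∸ i) * (x^ 1 · G -[1+ i ]) k) ∎
  where
  m = suc (suc q)
  G : ℤ → Poly
  G = endingIn (suc q)
  S : ℤ → ℕ
  S ℓ = ∑[ b < suc m ] (x^ finalDes± b (punchInℤ b ℓ) · G ℓ) k

rhsD-∑ : (m k : ℕ) →
  rhsD (suc m) k ≡ ∑[ j < m ] ((m ∸ j) * (x^ 2 · T m j) k + suc j * (x^ 1 · T m j) k)
                 + ∑[ i < m ] (suc i * T m (m + i) k + (m ∸ i) * (x^ 1 · T m (m + i)) k)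
rhsD-∑ m k = begin
  rhsD (suc m) k                                           ≡⟨ sumP-map _ (upTo m) k ⟩
  ∑[ i ∈ upTo m ] (lin (suc m ∸ i ∸ 1) (i + 1) ⊗ X i) k    ≡⟨ ∑-upTo m _ ⟩
  ∑[ i < m ] (lin (suc m ∸ i ∸ 1) (i + 1) ⊗ X i) k         ≡⟨ ∑<-cong m (λ i _ → term i) ⟩
  ∑[ i < m ] (A i + B i)                                   ≡⟨ ∑<-+ m A B ⟩
  ∑< m A + ∑< m B                                          ∎
  where
  X : ℕ → Poly
  X i = (mono 1 ⊗ T m i) ⊕ T m (m + i)
  A B : ℕ → ℕ
  A j = (m ∸ j) * (x^ 2 · T m j) k + suc j * (x^ 1 · T m j) k
  B i = suc i * T m (m + i) k + (m ∸ i) * (x^ 1 · T m (m + i)) k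
  term : ∀ i → (lin (suc m ∸ i ∸ 1) (i + 1) ⊗ X i) k ≡ A i + B i
  term i = begin
    (lin a (i + 1) ⊗ X i) k                                  ≡⟨ lin⊗ a (i + 1) (X i) k ⟩
    (i + 1) * X i k + a * (x^ 1 · X i) k
      ≡⟨ cong₂ (λ u v → (i + 1) * (u + T m (m + i) k) + a * v) (mono1⊗ (T m i) k)
           (trans (x^·-⊕ 1 _ _ k) (cong₂ _+_ (trans (x^·-cong 1 (mono1⊗ (T m i)) k) (x^·-x^· 1 1 (T m i) k)) refl)) ⟩
    (i + 1) * ((x^ 1 · T m i) k + T m (m + i) k) + a * ((x^ 2 · T m i) k + (x^ 1 · T m (m + i)) k)
      ≡⟨ cong₂ (λ c a → c * ((x^ 1 · T m i) k + T m (m + i) k) + a * ((x^ 2 · T m i) k + (x^ 1 · T m (m + i)) k))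
               (+-comm i 1) (trans (∸-+-assoc (suc m) i 1) (cong (suc m ∸_) (+-comm i 1))) ⟩
    suc i * ((x^ 1 · T m i) k + T m (m + i) k) + (m ∸ i) * ((x^ 2 · T m i) k + (x^ 1 · T m (m + i)) k)
      ≡⟨ solve 6 (λ c a x y z w → c :* (x :+ y) :+ a :* (z :+ w) := (a :* z :+ c :* x) :+ (c :* y :+ a :* w))
               refl (suc i) (m ∸ i) _ _ _ _ ⟩
    A i + B i                                                ∎
    where a = suc m ∸ i ∸ 1

proposition4p2 : (n : ℕ) → 4 ≤ n → (k : ℕ) → affineEulerianD n k ≡ rhsD n k
proposition4p2 (suc (suc (suc (suc q)))) _ k = begin
  affineEulerianD (suc m) k          ≡⟨ affineEulerianD-∑endingIn (suc q) k ⟩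
  ∑< m P + ∑< m N                    ≡⟨ cong₂ _+_ (∑<-cong m last⁺) (∑<-cong m last⁻) ⟩
  ∑[ i < m ] A (m ∸ suc i) + ∑< m B  ≡⟨ cong (_+ ∑< m B) (sym (∑<-reverse m A)) ⟩
  ∑< m A + ∑< m B                    ≡⟨ sym (rhsD-∑ m k) ⟩
  rhsD (suc m) k                     ∎
  where
  m = suc (suc (suc q))
  G = endingIn (suc (suc q))
  P N A B : ℕ → ℕ
  P i = suc i * (x^ 2 · G (ℤ.+ suc i)) k + (m ∸ i) * (x^ 1 · G (ℤ.+ suc i)) k
  N i = suc i * G -[1+ i ] k + (m ∸ i) * (x^ 1 · G -[1+ i ]) k
  A j = (m ∸ j) * (x^ 2 · T m j) k + suc j * (x^ 1 · T m j) k
  B i = suc i * T m (m + i) k + (m ∸ i) * (x^ 1 · T m (m + i)) k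
  last⁺ : ∀ i → i < m → P i ≡ A (m ∸ suc i)
  last⁺ i i<m = cong₂ _+_
    (cong₂ _*_ (sym (m∸[m∸n]≡n i<m)) (x^·-cong 2 (proj₁ (endingIn≗T (suc q) i i<m)) k))
    (cong₂ _*_ (+-∸-assoc 1 i<m) (x^·-cong 1 (proj₁ (endingIn≗T (suc q) i i<m)) k))
  last⁻ : ∀ i → i < m → N i ≡ B i
  last⁻ i i<m = cong₂ (λ u v → suc i * u + (m ∸ i) * v)
    (proj₂ (endingIn≗T (suc q) i i<m) k) (x^·-cong 1 (proj₂ (endingIn≗T (suc q) i i<m)) k)
proposition4p2 (suc (suc (suc zero))) (s≤s (s≤s (s≤s ())))
proposition4p2 (suc (suc zero))       (s≤s (s≤s ()))
proposition4p2 (suc zero)             (s≤s ())
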